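{- Let $Q,T$ be nonempty strings over a finite alphabet $\Sigma$ and let $\mathcal{A}=\{a_1,\dots,a_n\}$ be a set of exact match anchors between $Q$ and $T$. Let $\mathcal{A}'$ be the set obtained by breaking each anchor $a_i=([q_s..q_e],[t_s..t_e])$ into the length-1 anchors $a_{i,k}=([q_s+k],[t_s+k])$ for $k\in[0..q_e-q_s]$. Call two anchors $a=([q_s..q_e],[t_s..t_e])$, $a'=([q_s'..q_e'],[t_s'..t_e'])$ a perfect chain if $a\prec a'$ and $\mathrm{connect}(a,a')=0$; such a pair may be merged into the anchor $a\cdot a'=([q_s..q_e'],[t_s..t_e'])$. Let $\mathcal{A}''$ be any set of anchors obtained from $\mathcal{A}$ by arbitrarily splitting anchors into shorter anchors (each piece $([q_s+x..q_s+y],[t_s+x..t_s+y])$ of an anchor $([q_s..q_e],[t_s..t_e])$) and merging pairs forming perfect chains. Then the anchored edit distance and the optimal colinear chaining cost are the same for $\mathcal{A}$, $\mathcal{A}'$ and $\mathcal{A}''$.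
   Context: Strings are 1-indexed; $[x..y]=\{x,\dots,y\}$ and $[x]=[x..x]$; $Q[x..y]$ denotes the substring from position $x$ to $y$. An exact match anchor (anchor) between $Q$ and $T$ is a pair $a=([q_s..q_e],[t_s..t_e])$ with $1\le q_s\le q_e\le|Q|$, $1\le t_s\le t_e\le|T|$ and $Q[q_s..q_e]=T[t_s..t_e]$ (so $q_e-q_s=t_e-t_s$). For anchors $a=([q_s..q_e],[t_s..t_e])$, $a'=([q_s'..q_e'],[t_s'..t_e'])$: $a$ strictly precedes $a'$ ($a\prec a'$) if $q_s\le q_s'$, $q_e\le q_e'$, $t_s\le t_s'$, $t_e\le t_e'$ with at least one inequality strict. Define $\mathrm{connect}(a,a')=\mathrm{gap}(a,a')+\mathrm{overlap}(a,a')$ where $\mathrm{gap}(a,a')=\max(0,\,q_s'-q_e-1,\,t_s'-t_e-1)$ and $\mathrm{overlap}(a,a')=|\max(0,q_e-q_s'+1)-\max(0,t_e-t_s'+1)|$. A colinear chain is a sequence of anchors $a_1,\dots,a_c$ from the given set with $a_i\prec a_{i+1}$ for all $i$; its cost is $\sum_{i=0}^{c}\mathrm{connect}(a_i,a_{i+1})$ with the conventions $a_0=([0..0],[0..0])$ and $a_{c+1}=([|Q|+1..|Q|+1],[|T|+1..|T|+1])$. The optimal colinear chaining cost of an anchor set is the minimum cost of a colinear chain from it. Anchored edit distance: for an anchor set, a character match $Q[q_s+k]=T[t_s+k]$ with $k\in[0..t_e-t_s]$ for some anchor $([q_s..q_e],[t_s..t_e])$ in the set is called supported; the anchored edit distance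 is the minimum cost of an alignment of $Q$ and $T$ where supported matches cost 0, unsupported matches cost 1, and insertions, deletions and substitutions cost 1. -}

module Defs where

open import Data.Nat using (ℕ; zero; suc; _+_; _∸_; _≤_; _<_; _⊔_; ∣_-_∣)
open import Data.Fin using (Fin)
open import Data.Maybe using (Maybe; just; nothing)
open import Data.List using (List; []; _∷_; _++_; [_]; map; concatMap; upTo; length)
open import Data.List.Membership.Propositional using (_∈_)
open import Data.List.Relation.Unary.All using (All)
open import Data.List.Relation.Unary.Any using (Any)
open import Data.List.Relation.Unary.Linked using (Linked)
open import Data.List.Relation.Binary.Permutation.Propositional using (_↭_)
open import Data.Product using (Σ; _×_; ∃; ∃-syntax; _,_)
open import Data.Sum using (_⊎_)
open import Relation.Nullary using (¬_)
open import Relation.Binary.PropositionalEquality using (_≡_; _≢_)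

-- Strings over the finite alphabet Fin σ are lists; positions are 1-indexed.
-- charAt s i = the i-th character (nothing when i = 0 or i > |s|).
charAt : ∀ {σ} → List (Fin σ) → ℕ → Maybe (Fin σ)
charAt []       _             = nothing
charAt (x ∷ xs) zero          = nothing
charAt (x ∷ xs) (suc zero)    = just x
charAt (x ∷ xs) (suc (suc n)) = charAt xs (suc n)

record Anchor : Set where
  constructor mkA
  field
    qs qe ts te : ℕ
open Anchor public

IsAnchor : ∀ {σ} → List (Fin σ) → List (Fin σ) → Anchor → Set
IsAnchor Q T a =
  1 ≤ qs a × qs a ≤ qe a × qe a ≤ length Q ×
  1 ≤ ts a × ts a ≤ te a × te a ≤ length T ×
  (qe a ∸ qs a ≡ te a ∸ ts a) ×
  (∀ k → k ≤ qe a ∸ qs a → charAt Q (qs a + k) ≡ charAt T (ts a + k))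

_≺_ : Anchor → Anchor → Set
a ≺ a' = qs a ≤ qs a' × qe a ≤ qe a' × ts a ≤ ts a' × te a ≤ te a' ×
         (qs a < qs a' ⊎ qe a < qe a' ⊎ ts a < ts a' ⊎ te a < te a')

-- gap(a,a') = max(0, qs'-qe-1, ts'-te-1)   (truncated subtraction ∸ realises max with 0)
gap : Anchor → Anchor → ℕ
gap a a' = (qs a' ∸ suc (qe a)) ⊔ (ts a' ∸ suc (te a))

overlapAmt : Anchor → Anchor → ℕ
overlapAmt a a' = ∣ (suc (qe a) ∸ qs a') - (suc (te a) ∸ ts a') ∣

connect : Anchor → Anchor → ℕ
connect a a' = gap a a' + overlapAmt a a'

startAnchor : Anchor
startAnchor = mkA 0 0 0 0

endAnchor : ℕ → ℕ → Anchor
endAnchor m n = mkA (suc m) (suc m) (suc n) (suc n)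

connectSum : List Anchor → ℕ
connectSum (a ∷ b ∷ r) = connect a b + connectSum (b ∷ r)
connectSum _           = 0

IsChain : List Anchor → List Anchor → Set
IsChain A cs = All (_∈ A) cs × Linked _≺_ cs

chainCost : ∀ {σ} → List (Fin σ) → List (Fin σ) → List Anchor → ℕ
chainCost Q T cs = connectSum (startAnchor ∷ cs ++ [ endAnchor (length Q) (length T) ])

OptChainCost : ∀ {σ} → List (Fin σ) → List (Fin σ) → List Anchor → ℕ → Set
OptChainCost Q T A d =
  (∃[ cs ] (IsChain A cs × chainCost Q T cs ≡ d)) ×
  (∀ cs → IsChain A cs → d ≤ chainCost Q T cs)

Supported : List Anchor → ℕ → ℕ → Set
Supported A i j = Any (λ a → ∃[ k ] (k ≤ te a ∸ ts a × i ≡ qs a + k × j ≡ ts a + k)) A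

-- Alignment A i j xs ys c : an alignment of the suffixes xs (starting at position i of Q)
-- and ys (starting at position j of T), whose total cost is c.
data Alignment {σ} (A : List Anchor) : ℕ → ℕ → List (Fin σ) → List (Fin σ) → ℕ → Set where
  nil       : ∀ {i j} → Alignment A i j [] [] 0
  suppMatch : ∀ {i j x y xs ys c} → x ≡ y → Supported A i j →
              Alignment A (suc i) (suc j) xs ys c → Alignment A i j (x ∷ xs) (y ∷ ys) c
  unsMatch  : ∀ {i j x y xs ys c} → x ≡ y → ¬ Supported A i j →
              Alignment A (suc i) (suc j) xs ys c → Alignment A i j (x ∷ xs) (y ∷ ys) (suc c)
  subst     : ∀ {i j x y xs ys c} → x ≢ y →
              Alignment A (suc i) (suc j) xs ys c → Alignment A i j (x ∷ xs) (y ∷ ys) (suc c)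
  del       : ∀ {i j x xs ys c} →
              Alignment A (suc i) j xs ys c → Alignment A i j (x ∷ xs) ys (suc c)
  ins       : ∀ {i j y xs ys c} →
              Alignment A i (suc j) xs ys c → Alignment A i j xs (y ∷ ys) (suc c)

AnchoredED : ∀ {σ} → List (Fin σ) → List (Fin σ) → List Anchor → ℕ → Set
AnchoredED Q T A d = Alignment A 1 1 Q T d × (∀ c → Alignment A 1 1 Q T c → d ≤ c)

breakAnchor : Anchor → List Anchor
breakAnchor a = map (λ k → mkA (qs a + k) (qs a + k) (ts a + k) (ts a + k)) (upTo (suc (qe a ∸ qs a)))

breakAll : List Anchor → List Anchor
breakAll = concatMap breakAnchor

merge : Anchor → Anchor → Anchor
merge a a' = mkA (qs a) (qe a') (ts a) (te a')

data Derivable : List Anchor → List Anchor → Set where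
  done  : ∀ {A} → Derivable A A
  split : ∀ {A B C} (a : Anchor) (x : ℕ) → A ↭ (a ∷ B) → x < qe a ∸ qs a →
          Derivable (mkA (qs a) (qs a + x) (ts a) (ts a + x) ∷
                     mkA (suc (qs a + x)) (qe a) (suc (ts a + x)) (te a) ∷ B) C →
          Derivable A C
  merg  : ∀ {A B C} (a a' : Anchor) → A ↭ (a ∷ a' ∷ B) → a ≺ a' → connect a a' ≡ 0 →
          Derivable (merge a a' ∷ B) C → Derivable A C

{-# OPTIONS --safe #-}
-- Both quantities are determined by the set of supported cells, i.e. the pairs (i , j) whose match
-- Q[i] = T[j] is covered by an anchor: for the anchored edit distance this is immediate, and for the
-- chaining cost it follows from the fact that, for valid anchors, the optimal chaining cost equals the
-- anchored edit distance. Breaking, splitting and merging a perfect chain (two anchors on one diagonal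
-- that touch or overlap) preserve validity and the supported cells.
--
-- For the equality, write connect as the largest of the two gaps and the shift between the
-- diagonals of the two anchors. A chain yields an alignment by walking from each anchor towards the
-- diagonal of the next, every step costing one and strictly decreasing that quantity, and then
-- following the next anchor through free supported matches. An alignment yields a chain by scanning
-- it while keeping a chain whose cost up to the current cell is at most what the alignment has paid
-- so far: an edit moves the current cell at an extra connection cost of at most one, a match inside
-- the last anchor is free, and at any other supported match we append the supporting anchor, first
-- discarding the anchors that do not precede it, which by the triangle inequality for connect does
-- not increase the cost.
module Submission where

open import Defs renaming (subst to sub)
open import Data.Nat
open import Data.Nat.Properties
open import Data.Nat.Tactic.RingSolver using (solve; solve-∀)
open import Algebra.Properties.CommutativeSemigroup +-commutativeSemigroup using (x∙yz≈y∙xz; xy∙z≈y∙xz)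
open import Data.Fin using (Fin) renaming (_≟_ to _≟ᶠ_)
open import Data.Maybe using (just)
open import Data.Maybe.Properties using (just-injective)
open import Data.List using (List; []; _∷_; _++_; [_]; length; reverse; drop)
open import Data.List.Properties using (unfold-reverse; drop-all)
open import Data.List.Membership.Propositional using (_∈_; find; lose)
open import Data.List.Membership.Propositional.Properties using (∈-upTo⁺; ∈-upTo⁻)
open import Data.List.Relation.Unary.Any using (Any; here; there; any?)
import Data.List.Relation.Unary.Any.Properties as Anyₚ
open import Data.List.Relation.Binary.Permutation.Propositional using (_↭_; ↭-sym)
open import Data.List.Relation.Binary.Permutation.Propositional.Properties using (All-resp-↭; Any-resp-↭)
open import Data.Product using (Σ-syntax; _×_; _,_; proj₁; proj₂; ∃-syntax)
open import Data.Sum using (_⊎_; inj₁; inj₂; [_,_])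
open import Data.Sum.Function.Propositional using (_⊎-⇔_)
open import Data.Unit using (⊤; tt)
open import Data.Empty using (⊥-elim)
open import Function.Bundles using (_⇔_; mk⇔; Equivalence)
import Function.Properties.Equivalence as ⇔
open import Relation.Nullary using (Dec; yes; no)
open import Relation.Binary.Definitions using (tri<; tri≈; tri>)
open import Relation.Binary.PropositionalEquality hiding ([_])

m+o≡n⇒m≤n : ∀ {m n} o → m + o ≡ n → m ≤ n
m+o≡n⇒m≤n {m} o refl = m≤m+n m o

m+p≤n+o⇒m≤n : ∀ {m n o p} → o ≤ p → m + p ≤ n + o → m ≤ n
m+p≤n+o⇒m≤n {m} {n} {o} {p} o≤p le = +-cancelʳ-≤ p m n (≤-trans le (+-monoʳ-≤ n o≤p))

≤⇒∸≤ : ∀ {m n o} → m ≤ n → m ∸ n ≤ o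
≤⇒∸≤ m≤n = ≤-trans (≤-reflexive (m≤n⇒m∸n≡0 m≤n)) z≤n

∸≤+∸ : ∀ c m n m′ n′ → m + n′ ≤ c + (n + m′) → m ∸ n ≤ c + (m′ ∸ n′)
∸≤+∸ c m n m′ n′ le = m≤n+o⇒m∸n≤o m n (+-cancelʳ-≤ n′ m _ (begin
  m + n′                          ≤⟨ le ⟩
  c + (n + m′)                    ≤⟨ +-monoʳ-≤ c (+-monoʳ-≤ n (m≤n+m∸n m′ n′)) ⟩
  c + (n + (n′ + (m′ ∸ n′)))      ≡⟨ rearrange c n n′ (m′ ∸ n′) ⟩
  n + (c + (m′ ∸ n′)) + n′        ∎))
  where
  open ≤-Reasoning
  rearrange : ∀ c n n′ d → c + (n + (n′ + d)) ≡ n + (c + d) + n′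
  rearrange = solve-∀

∸≤∸ : ∀ m n m′ n′ → m + n′ ≤ n + m′ → m ∸ n ≤ m′ ∸ n′
∸≤∸ = ∸≤+∸ 0

∸≤∸+∸ : ∀ m n m₁ n₁ m₂ n₂ → m + (n₁ + n₂) ≤ n + (m₁ + m₂) → m ∸ n ≤ (m₁ ∸ n₁) + (m₂ ∸ n₂)
∸≤∸+∸ m n m₁ n₁ m₂ n₂ le = m≤n+o⇒m∸n≤o m n (+-cancelʳ-≤ (n₁ + n₂) m _ (begin
  m + (n₁ + n₂)                                  ≤⟨ le ⟩
  n + (m₁ + m₂)                                  ≤⟨ +-monoʳ-≤ n (+-mono-≤ (m≤n+m∸n m₁ n₁) (m≤n+m∸n m₂ n₂)) ⟩
  n + ((n₁ + (m₁ ∸ n₁)) + (n₂ + (m₂ ∸ n₂)))      ≡⟨ rearrange n n₁ n₂ (m₁ ∸ n₁) (m₂ ∸ n₂) ⟩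
  n + ((m₁ ∸ n₁) + (m₂ ∸ n₂)) + (n₁ + n₂)        ∎))
  where
  open ≤-Reasoning
  rearrange : ∀ n n₁ n₂ d₁ d₂ → n + ((n₁ + d₁) + (n₂ + d₂)) ≡ n + (d₁ + d₂) + (n₁ + n₂)
  rearrange = solve-∀

∸≤+-trans : ∀ c m n m′ n′ {G} → m + n′ ≤ c + (n + m′) → m′ ∸ n′ ≤ G → m ∸ n ≤ c + G
∸≤+-trans c m n m′ n′ le h = ≤-trans (∸≤+∸ c m n m′ n′ le) (+-monoʳ-≤ c h)

∸<∸ : ∀ m n m′ n′ → n < m → m′ + n < m + n′ → m′ ∸ n′ < m ∸ n
∸<∸ m n m′ n′ n<m lt with ≤-total n′ m′
... | inj₁ n′≤m′ = m+n≤o⇒m≤o∸n (suc (m′ ∸ n′)) (+-cancelʳ-≤ n′ _ _ (begin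
  suc (m′ ∸ n′) + n + n′   ≡⟨ rearrange n n′ (m′ ∸ n′) ⟩
  suc ((m′ ∸ n′) + n′ + n) ≡⟨ cong (λ x → suc (x + n)) (m∸n+n≡m n′≤m′) ⟩
  suc (m′ + n)             ≤⟨ lt ⟩
  m + n′                   ∎))
  where
  open ≤-Reasoning
  rearrange : ∀ n n′ d → suc d + n + n′ ≡ suc (d + n′ + n)
  rearrange = solve-∀
... | inj₂ m′≤n′ = subst (_< m ∸ n) (sym (m≤n⇒m∸n≡0 m′≤n′)) (m+n≤o⇒m≤o∸n 1 n<m)

≡-through : ∀ K {L R u v} → u ≡ v → L ≡ K + u → K + v ≡ R → L ≡ R
≡-through K refl e₁ e₂ = trans e₁ e₂

m≤n⇒o+n<m+p⇒o<p : ∀ {m n o p} → m ≤ n → o + n < m + p → o < p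
m≤n⇒o+n<m+p⇒o<p {m} {n} {o} {p} m≤n lt =
  +-cancelʳ-< n o p (<-≤-trans lt (≤-trans (+-monoˡ-≤ p m≤n) (≤-reflexive (+-comm n p))))

m≤n⇒m+o≡p+n⇒p≤o : ∀ {m n o p} → m ≤ n → m + o ≡ p + n → p ≤ o
m≤n⇒m+o≡p+n⇒p≤o {m} {n} {o} {p} m≤n eq =
  +-cancelʳ-≤ n p o (≤-trans (≤-reflexive (sym eq)) (≤-trans (+-monoˡ-≤ o m≤n) (≤-reflexive (+-comm n o))))

-- `connect` in closed form: with (X , Y) one past the end of the earlier anchor and
-- (A , B) the start of the later one, it is the largest of the two gaps A ∸ X, B ∸ Y
-- and the distance |(A + Y) - (B + X)| between the diagonals of the two anchors.
jump : ℕ → ℕ → ℕ → ℕ → ℕ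
jump A X B Y = (A ∸ X) ⊔ (B ∸ Y) ⊔ ((A + Y) ∸ (B + X)) ⊔ ((B + X) ∸ (A + Y))

module _ (A X B Y : ℕ) where

  gapQ≤jump : A ∸ X ≤ jump A X B Y
  gapQ≤jump = ≤-trans (m≤m⊔n _ _) (≤-trans (m≤m⊔n _ _) (m≤m⊔n _ _))

  gapT≤jump : B ∸ Y ≤ jump A X B Y
  gapT≤jump = ≤-trans (m≤n⊔m (A ∸ X) _) (≤-trans (m≤m⊔n _ _) (m≤m⊔n _ _))

  shiftT≤jump : (A + Y) ∸ (B + X) ≤ jump A X B Y
  shiftT≤jump = ≤-trans (m≤n⊔m ((A ∸ X) ⊔ (B ∸ Y)) _) (m≤m⊔n _ _)

  shiftQ≤jump : (B + X) ∸ (A + Y) ≤ jump A X B Y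
  shiftQ≤jump = m≤n⊔m _ _

  jump-lub : ∀ {G} → A ∸ X ≤ G → B ∸ Y ≤ G → (A + Y) ∸ (B + X) ≤ G → (B + X) ∸ (A + Y) ≤ G →
             jump A X B Y ≤ G
  jump-lub h₁ h₂ h₃ h₄ = ⊔-lub (⊔-lub (⊔-lub h₁ h₂) h₃) h₄

  jump<-lub : ∀ {G} → A ∸ X < G → B ∸ Y < G → (A + Y) ∸ (B + X) < G → (B + X) ∸ (A + Y) < G →
              jump A X B Y < G
  jump<-lub h₁ h₂ h₃ h₄ = ⊔-lub (⊔-lub (⊔-lub h₁ h₂) h₃) h₄

jump-sym : ∀ A X B Y → jump A X B Y ≡ jump B Y A X
jump-sym A X B Y = ≤-antisym (≤ A X B Y) (≤ B Y A X)
  where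
  ≤ : ∀ A X B Y → jump A X B Y ≤ jump B Y A X
  ≤ A X B Y = jump-lub A X B Y (gapT≤jump B Y A X) (gapQ≤jump B Y A X) (shiftQ≤jump B Y A X) (shiftT≤jump B Y A X)

jump-sucA≤ : ∀ A X B Y → jump (suc A) X B Y ≤ suc (jump A X B Y)
jump-sucA≤ A X B Y = jump-lub (suc A) X B Y
  (∸≤+-trans 1 (suc A) X A X (m+o≡n⇒m≤n 0 (solve (A ∷ X ∷ []))) (gapQ≤jump A X B Y))
  (∸≤+-trans 1 B Y B Y (m+o≡n⇒m≤n 1 (solve (B ∷ Y ∷ []))) (gapT≤jump A X B Y))
  (∸≤+-trans 1 (suc A + Y) (B + X) (A + Y) (B + X) (m+o≡n⇒m≤n 0 (solve (A ∷ B ∷ X ∷ Y ∷ []))) (shiftT≤jump A X B Y))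
  (∸≤+-trans 1 (B + X) (suc A + Y) (B + X) (A + Y) (m+o≡n⇒m≤n 2 (solve (A ∷ B ∷ X ∷ Y ∷ []))) (shiftQ≤jump A X B Y))

jump-sucB≤ : ∀ A X B Y → jump A X (suc B) Y ≤ suc (jump A X B Y)
jump-sucB≤ A X B Y = subst₂ _≤_ (jump-sym (suc B) Y A X) (cong suc (jump-sym B Y A X)) (jump-sucA≤ B Y A X)

jump-sucAB≤ : ∀ A X B Y → jump (suc A) X (suc B) Y ≤ suc (jump A X B Y)
jump-sucAB≤ A X B Y = jump-lub (suc A) X (suc B) Y
  (∸≤+-trans 1 (suc A) X A X (m+o≡n⇒m≤n 0 (solve (A ∷ X ∷ []))) (gapQ≤jump A X B Y))
  (∸≤+-trans 1 (suc B) Y B Y (m+o≡n⇒m≤n 0 (solve (B ∷ Y ∷ []))) (gapT≤jump A X B Y))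
  (∸≤+-trans 1 (suc A + Y) (suc B + X) (A + Y) (B + X) (m+o≡n⇒m≤n 1 (solve (A ∷ B ∷ X ∷ Y ∷ []))) (shiftT≤jump A X B Y))
  (∸≤+-trans 1 (suc B + X) (suc A + Y) (B + X) (A + Y) (m+o≡n⇒m≤n 1 (solve (A ∷ B ∷ X ∷ Y ∷ []))) (shiftQ≤jump A X B Y))

jump-sucAB≤-inside : ∀ A X B Y → A < X ⊎ B < Y → jump (suc A) X (suc B) Y ≤ jump A X B Y
jump-sucAB≤-inside A X B Y (inj₁ A<X) = jump-lub (suc A) X (suc B) Y
  (≤⇒∸≤ A<X)
  (≤-trans (∸≤∸ (suc B) Y (B + X) (A + Y) (m+p≤n+o⇒m≤n A<X (m+o≡n⇒m≤n 0 (solve (A ∷ B ∷ X ∷ Y ∷ [])))))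
           (shiftQ≤jump A X B Y))
  (≤-trans (∸≤∸ (suc A + Y) (suc B + X) (A + Y) (B + X) (m+o≡n⇒m≤n 0 (solve (A ∷ B ∷ X ∷ Y ∷ [])))) (shiftT≤jump A X B Y))
  (≤-trans (∸≤∸ (suc B + X) (suc A + Y) (B + X) (A + Y) (m+o≡n⇒m≤n 0 (solve (A ∷ B ∷ X ∷ Y ∷ [])))) (shiftQ≤jump A X B Y))
jump-sucAB≤-inside A X B Y (inj₂ B<Y) =
  subst₂ _≤_ (jump-sym (suc B) Y (suc A) X) (jump-sym B Y A X) (jump-sucAB≤-inside B Y A X (inj₁ B<Y))

jump-mono-AB : ∀ A X B Y k → jump A X B Y ≤ jump (A + k) X (B + k) Y
jump-mono-AB A X B Y k = jump-lub A X B Y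
  (≤-trans (∸≤∸ A X (A + k) X (m+o≡n⇒m≤n k (solve (A ∷ X ∷ k ∷ [])))) (gapQ≤jump (A + k) X (B + k) Y))
  (≤-trans (∸≤∸ B Y (B + k) Y (m+o≡n⇒m≤n k (solve (B ∷ Y ∷ k ∷ [])))) (gapT≤jump (A + k) X (B + k) Y))
  (≤-trans (∸≤∸ (A + Y) (B + X) (A + k + Y) (B + k + X) (m+o≡n⇒m≤n 0 (solve (A ∷ B ∷ X ∷ Y ∷ k ∷ []))))
           (shiftT≤jump (A + k) X (B + k) Y))
  (≤-trans (∸≤∸ (B + X) (A + Y) (B + k + X) (A + k + Y) (m+o≡n⇒m≤n 0 (solve (A ∷ B ∷ X ∷ Y ∷ k ∷ []))))
           (shiftQ≤jump (A + k) X (B + k) Y))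

jump-on-diagonal : ∀ A X B Y → A ≤ X → B ≤ Y → A + Y ≡ B + X → jump A X B Y ≡ 0
jump-on-diagonal A X B Y A≤X B≤Y eq =
  n≤0⇒n≡0 (jump-lub A X B Y (≤⇒∸≤ A≤X) (≤⇒∸≤ B≤Y) (≤⇒∸≤ (≤-reflexive eq)) (≤⇒∸≤ (≤-reflexive (sym eq))))

jump≡0⇒on-diagonal : ∀ A X B Y → jump A X B Y ≡ 0 → A ≤ X × B ≤ Y × A + Y ≡ B + X
jump≡0⇒on-diagonal A X B Y j≡0 =
  vanishes (gapQ≤jump A X B Y) , vanishes (gapT≤jump A X B Y) ,
  ≤-antisym (vanishes (shiftT≤jump A X B Y)) (vanishes (shiftQ≤jump A X B Y))
  where
  vanishes : ∀ {m n} → m ∸ n ≤ jump A X B Y → m ≤ n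
  vanishes le = m∸n≡0⇒m≤n (n≤0⇒n≡0 (≤-trans le (≤-reflexive j≡0)))

-- The middle anchor starts at (A′ , B′), ends just before (X′ , Y′), and lies on one diagonal.
jump-triangle : ∀ A X B Y A′ B′ X′ Y′ → A′ + Y′ ≡ B′ + X′ → A < A′ ⊎ B < B′ →
                jump A X B Y ≤ jump A′ X B′ Y + jump A X′ B Y′
jump-triangle A X B Y A′ B′ X′ Y′ diag before = jump-lub A X B Y (gapQ before) (gapT before)
  (≤-trans (∸≤∸+∸ (A + Y) (B + X) (A′ + Y) (B′ + X) (A + Y′) (B + X′)
     (≤-reflexive (≡-through (A + Y + X + B) (sym diag)
                    (solve (A ∷ Y ∷ X ∷ B ∷ B′ ∷ X′ ∷ [])) (solve (A ∷ Y ∷ X ∷ B ∷ A′ ∷ Y′ ∷ [])))))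
     (+-mono-≤ (shiftT≤jump A′ X B′ Y) (shiftT≤jump A X′ B Y′)))
  (≤-trans (∸≤∸+∸ (B + X) (A + Y) (B′ + X) (A′ + Y) (B + X′) (A + Y′)
     (≤-reflexive (≡-through (A + Y + X + B) diag
                    (solve (A ∷ Y ∷ X ∷ B ∷ A′ ∷ Y′ ∷ [])) (solve (A ∷ Y ∷ X ∷ B ∷ B′ ∷ X′ ∷ [])))))
     (+-mono-≤ (shiftQ≤jump A′ X B′ Y) (shiftQ≤jump A X′ B Y′)))
  where
  rhs : ℕ
  rhs = jump A′ X B′ Y + jump A X′ B Y′
  gapQ : A < A′ ⊎ B < B′ → A ∸ X ≤ rhs
  gapQ (inj₁ A<A′) = ≤-trans (∸≤∸ A X A′ X (m+p≤n+o⇒m≤n A<A′ (m+o≡n⇒m≤n 1 (solve (A ∷ X ∷ A′ ∷ [])))))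
                             (≤-trans (gapQ≤jump A′ X B′ Y) (m≤m+n _ _))
  gapQ (inj₂ B<B′) = ≤-trans (∸≤∸+∸ A X A′ X (A + Y′) (B + X′)
     (m+p≤n+o⇒m≤n (<⇒≤ B<B′) (≤-reflexive (≡-through (A + X + B) (sym diag)
                                 (solve (A ∷ X ∷ B ∷ X′ ∷ B′ ∷ [])) (solve (A ∷ X ∷ B ∷ A′ ∷ Y′ ∷ []))))))
     (+-mono-≤ (gapQ≤jump A′ X B′ Y) (shiftT≤jump A X′ B Y′))
  gapT : A < A′ ⊎ B < B′ → B ∸ Y ≤ rhs
  gapT (inj₂ B<B′) = ≤-trans (∸≤∸ B Y B′ Y (m+p≤n+o⇒m≤n B<B′ (m+o≡n⇒m≤n 1 (solve (B ∷ Y ∷ B′ ∷ [])))))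
                             (≤-trans (gapT≤jump A′ X B′ Y) (m≤m+n _ _))
  gapT (inj₁ A<A′) = ≤-trans (∸≤∸+∸ B Y B′ Y (B + X′) (A + Y′)
     (m+p≤n+o⇒m≤n (<⇒≤ A<A′) (≤-reflexive (≡-through (B + Y + A) diag
                                 (solve (B ∷ Y ∷ A ∷ A′ ∷ Y′ ∷ [])) (solve (B ∷ Y ∷ A ∷ B′ ∷ X′ ∷ []))))))
     (+-mono-≤ (gapT≤jump A′ X B′ Y) (shiftQ≤jump A X′ B Y′))

jump-sucXY< : ∀ A X B Y → X < A → Y < B → jump A (suc X) B (suc Y) < jump A X B Y
jump-sucXY< A X B Y X<A Y<B = jump<-lub A (suc X) B (suc Y)
  (≤-trans (∸<∸ A X A (suc X) X<A (m+o≡n⇒m≤n 0 (solve (A ∷ X ∷ [])))) (gapQ≤jump A X B Y))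
  (≤-trans (∸<∸ B Y B (suc Y) Y<B (m+o≡n⇒m≤n 0 (solve (B ∷ Y ∷ [])))) (gapT≤jump A X B Y))
  (≤-trans (∸<∸ A X (A + suc Y) (B + suc X) X<A (m+p≤n+o⇒m≤n Y<B (m+o≡n⇒m≤n 0 (solve (A ∷ B ∷ X ∷ Y ∷ [])))))
           (gapQ≤jump A X B Y))
  (≤-trans (∸<∸ B Y (B + suc X) (A + suc Y) Y<B (m+p≤n+o⇒m≤n X<A (m+o≡n⇒m≤n 0 (solve (A ∷ B ∷ X ∷ Y ∷ [])))))
           (gapT≤jump A X B Y))

jump-sucX< : ∀ A X B Y → B ≤ Y → B + X < A + Y → jump A (suc X) B Y < jump A X B Y
jump-sucX< A X B Y B≤Y below = jump<-lub A (suc X) B Y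
  (shift A (suc X) (m+p≤n+o⇒m≤n B≤Y (m+o≡n⇒m≤n 0 (solve (A ∷ B ∷ X ∷ Y ∷ [])))))
  (shift B Y (≤-trans (≤-reflexive (cong suc (+-comm B (B + X)))) (+-mono-≤ below B≤Y)))
  (shift (A + Y) (B + suc X) (m+o≡n⇒m≤n 0 (solve (A ∷ B ∷ X ∷ Y ∷ []))))
  (shift (B + suc X) (A + Y) (≤-trans (≤-reflexive (double B X)) (+-mono-≤ below below)))
  where
  double : ∀ B X → suc (B + suc X + (B + X)) ≡ suc (B + X) + suc (B + X)
  double = solve-∀
  shift : ∀ m n → m + (B + X) < (A + Y) + n → m ∸ n < jump A X B Y
  shift m n lt = ≤-trans (∸<∸ (A + Y) (B + X) m n below lt) (shiftT≤jump A X B Y)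

jump-sucY< : ∀ A X B Y → A ≤ X → A + Y < B + X → jump A X B (suc Y) < jump A X B Y
jump-sucY< A X B Y A≤X above =
  subst₂ _<_ (jump-sym B (suc Y) A X) (jump-sym B Y A X) (jump-sucX< B Y A X A≤X above)

gap+overlap : ℕ → ℕ → ℕ → ℕ → ℕ
gap+overlap A X B Y = (A ∸ X) ⊔ (B ∸ Y) + ∣ (X ∸ A) - (Y ∸ B) ∣

gap+overlap-sym : ∀ A X B Y → gap+overlap A X B Y ≡ gap+overlap B Y A X
gap+overlap-sym A X B Y = cong₂ _+_ (⊔-comm (A ∸ X) (B ∸ Y)) (∣-∣-comm (X ∸ A) (Y ∸ B))

private
  gaps : ∀ A X B Y → X ≤ A → Y ≤ B → gap+overlap A X B Y ≡ jump A X B Y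
  gaps A X B Y X≤A Y≤B = trans no-overlap (≤-antisym
    (≤-trans (m≤m⊔n _ _) (m≤m⊔n _ _))
    (jump-lub A X B Y (m≤m⊔n _ _) (m≤n⊔m _ _)
      (≤-trans (∸≤∸ (A + Y) (B + X) A X (m+p≤n+o⇒m≤n Y≤B (m+o≡n⇒m≤n 0 (solve (A ∷ B ∷ X ∷ Y ∷ []))))) (m≤m⊔n _ _))
      (≤-trans (∸≤∸ (B + X) (A + Y) B Y (m+p≤n+o⇒m≤n X≤A (m+o≡n⇒m≤n 0 (solve (A ∷ B ∷ X ∷ Y ∷ []))))) (m≤n⊔m _ _))))
    where
    no-overlap : gap+overlap A X B Y ≡ (A ∸ X) ⊔ (B ∸ Y)
    no-overlap = trans (cong₂ (λ p q → (A ∸ X) ⊔ (B ∸ Y) + ∣ p - q ∣) (m≤n⇒m∸n≡0 X≤A) (m≤n⇒m∸n≡0 Y≤B))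
                       (+-identityʳ _)

  gap-overlap : ∀ A X B Y → X ≤ A → B ≤ Y → gap+overlap A X B Y ≡ jump A X B Y
  gap-overlap A X B Y X≤A B≤Y with m≤n⇒∃[o]m+o≡n X≤A | m≤n⇒∃[o]m+o≡n B≤Y
  ... | a , refl | v , refl = trans value (≤-antisym
    (≤-trans (m+n≤o⇒m≤o∸n (a + v) {B + X} {X + a + (B + v)} (m+o≡n⇒m≤n 0 (solve (a ∷ v ∷ B ∷ X ∷ []))))
             (shiftT≤jump (X + a) X B (B + v)))
    (jump-lub (X + a) X B (B + v)
      (m≤n+o⇒m∸n≤o (X + a) X (m+o≡n⇒m≤n v (solve (X ∷ a ∷ v ∷ []))))
      (≤⇒∸≤ (m≤m+n B v))
      (m≤n+o⇒m∸n≤o (X + a + (B + v)) (B + X) (m+o≡n⇒m≤n 0 (solve (a ∷ v ∷ B ∷ X ∷ []))))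
      (≤⇒∸≤ {B + X} {X + a + (B + v)} (m+o≡n⇒m≤n (a + v) (solve (a ∷ v ∷ B ∷ X ∷ []))))))
    where
    value : gap+overlap (X + a) X B (B + v) ≡ a + v
    value = cong₂ _+_ (trans (cong₂ _⊔_ (m+n∸m≡n X a) (m≤n⇒m∸n≡0 (m≤m+n B v))) (⊔-identityʳ a))
                      (cong₂ ∣_-_∣ (m≤n⇒m∸n≡0 (m≤m+n X a)) (m+n∸m≡n B v))

  overlaps : ∀ A X B Y → A ≤ X → B ≤ Y → X ∸ A ≤ Y ∸ B → gap+overlap A X B Y ≡ jump A X B Y
  overlaps A X B Y A≤X B≤Y X∸A≤Y∸B with m≤n⇒∃[o]m+o≡n A≤X | m≤n⇒∃[o]m+o≡n B≤Y
  ... | u , refl | v , refl = trans value (≤-antisym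
    (≤-trans (∸≤∸ v u (A + (B + v)) (B + (A + u)) (m+o≡n⇒m≤n 0 (solve (A ∷ B ∷ u ∷ v ∷ []))))
             (shiftT≤jump A (A + u) B (B + v)))
    (jump-lub A (A + u) B (B + v) (≤⇒∸≤ (m≤m+n A u)) (≤⇒∸≤ (m≤m+n B v))
      (∸≤∸ (A + (B + v)) (B + (A + u)) v u (m+o≡n⇒m≤n 0 (solve (A ∷ B ∷ u ∷ v ∷ []))))
      (≤⇒∸≤ {B + (A + u)} {A + (B + v)} (m+p≤n+o⇒m≤n u≤v (m+o≡n⇒m≤n 0 (solve (A ∷ B ∷ u ∷ v ∷ [])))))))
    where
    u≤v : u ≤ v
    u≤v = subst₂ _≤_ (m+n∸m≡n A u) (m+n∸m≡n B v) X∸A≤Y∸B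
    value : gap+overlap A (A + u) B (B + v) ≡ v ∸ u
    value = trans (cong₂ _+_ (cong₂ _⊔_ (m≤n⇒m∸n≡0 (m≤m+n A u)) (m≤n⇒m∸n≡0 (m≤m+n B v)))
                             (cong₂ ∣_-_∣ (m+n∸m≡n A u) (m+n∸m≡n B v)))
                  (m≤n⇒∣m-n∣≡n∸m u≤v)

gap+overlap≡jump : ∀ A X B Y → gap+overlap A X B Y ≡ jump A X B Y
gap+overlap≡jump A X B Y with ≤-total X A | ≤-total Y B
... | inj₁ X≤A | inj₁ Y≤B = gaps A X B Y X≤A Y≤B
... | inj₁ X≤A | inj₂ B≤Y = gap-overlap A X B Y X≤A B≤Y
... | inj₂ A≤X | inj₁ Y≤B = trans (gap+overlap-sym A X B Y) (trans (gap-overlap B Y A X Y≤B A≤X) (jump-sym B Y A X))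
... | inj₂ A≤X | inj₂ B≤Y with ≤-total (X ∸ A) (Y ∸ B)
...   | inj₁ u≤v = overlaps A X B Y A≤X B≤Y u≤v
...   | inj₂ v≤u = trans (gap+overlap-sym A X B Y) (trans (overlaps B Y A X B≤Y A≤X v≤u) (jump-sym B Y A X))

-- The ring solver's variable lists would clash with the list-like constructors of All and Linked.
open import Data.List.Relation.Unary.All as All using (All; []; _∷_)
import Data.List.Relation.Unary.All.Properties as Allₚ
open import Data.List.Relation.Unary.Linked as Linked using (Linked; []; [-]; _∷_)

module Valid {σ} (Q T : List (Fin σ)) {a : Anchor} where

  1≤qs : IsAnchor Q T a → 1 ≤ qs a
  1≤qs (p , _) = p

  1≤ts : IsAnchor Q T a → 1 ≤ ts a
  1≤ts (_ , _ , _ , p , _) = p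

  qs≤qe : IsAnchor Q T a → qs a ≤ qe a
  qs≤qe (_ , p , _) = p

  qe≤∣Q∣ : IsAnchor Q T a → qe a ≤ length Q
  qe≤∣Q∣ (_ , _ , p , _) = p

  ts≤te : IsAnchor Q T a → ts a ≤ te a
  ts≤te (_ , _ , _ , _ , p , _) = p

  te≤∣T∣ : IsAnchor Q T a → te a ≤ length T
  te≤∣T∣ (_ , _ , _ , _ , _ , p , _) = p

  lengths≡ : IsAnchor Q T a → qe a ∸ qs a ≡ te a ∸ ts a
  lengths≡ (_ , _ , _ , _ , _ , _ , p , _) = p

  matches : IsAnchor Q T a → ∀ k → k ≤ qe a ∸ qs a → charAt Q (qs a + k) ≡ charAt T (ts a + k)
  matches (_ , _ , _ , _ , _ , _ , _ , p) = p

  on-diagonal : IsAnchor Q T a → qs a + suc (te a) ≡ ts a + suc (qe a)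
  on-diagonal v = begin
    qs a + suc (te a)                     ≡⟨ cong (λ z → qs a + suc z) (sym (m+[n∸m]≡n (ts≤te v))) ⟩
    qs a + suc (ts a + (te a ∸ ts a))     ≡⟨ swap (qs a) (ts a) (te a ∸ ts a) ⟩
    ts a + suc (qs a + (te a ∸ ts a))     ≡⟨ cong (λ z → ts a + suc (qs a + z)) (sym (lengths≡ v)) ⟩
    ts a + suc (qs a + (qe a ∸ qs a))     ≡⟨ cong (λ z → ts a + suc z) (m+[n∸m]≡n (qs≤qe v)) ⟩
    ts a + suc (qe a)                     ∎
    where
    open ≡-Reasoning
    swap : ∀ x y d → x + suc (y + d) ≡ y + suc (x + d)
    swap = solve-∀

  qs+k≤qe : IsAnchor Q T a → ∀ {k} → k ≤ te a ∸ ts a → qs a + k ≤ qe a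
  qs+k≤qe v k≤ = ≤-trans (+-monoʳ-≤ (qs a) (≤-trans k≤ (≤-reflexive (sym (lengths≡ v))))) (≤-reflexive (m+[n∸m]≡n (qs≤qe v)))

  ts+k≤te : IsAnchor Q T a → ∀ {k} → k ≤ te a ∸ ts a → ts a + k ≤ te a
  ts+k≤te v k≤ = ≤-trans (+-monoʳ-≤ (ts a) k≤) (≤-reflexive (m+[n∸m]≡n (ts≤te v)))

connect≡jump : ∀ a b → connect a b ≡ jump (qs b) (suc (qe a)) (ts b) (suc (te a))
connect≡jump a b = gap+overlap≡jump (qs b) (suc (qe a)) (ts b) (suc (te a))

Diagonal : ℕ → ℕ → ℕ → ℕ → ℕ → Set
Diagonal s t L i j = ∃[ k ] (k ≤ L × i ≡ s + k × j ≡ t + k)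

Covers : Anchor → ℕ → ℕ → Set
Covers a = Diagonal (qs a) (ts a) (te a ∸ ts a)

covers? : ∀ a i j → Dec (Covers a i j)
covers? a i j with qs a ≤? i
... | no qs≰i = no λ { (k , _ , refl , _) → qs≰i (m≤m+n (qs a) k) }
... | yes qs≤i with i ∸ qs a ≤? te a ∸ ts a | j ≟ ts a + (i ∸ qs a)
...   | yes k≤ | yes refl = yes (i ∸ qs a , k≤ , sym (m+[n∸m]≡n qs≤i) , refl)
...   | no k≰  | _        = no λ { (k , k≤ , refl , _) → k≰ (subst (_≤ te a ∸ ts a) (sym (m+n∸m≡n (qs a) k)) k≤) }
...   | yes _  | no j≢    = no λ { (k , _ , refl , refl) → j≢ (cong (ts a +_) (sym (m+n∸m≡n (qs a) k))) }

supported? : ∀ A i j → Dec (Supported A i j)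
supported? A i j = any? (λ a → covers? a i j) A

-- A single cell as an anchor. As the target of connect it stands for the alignment state just
-- before Q[i] and T[j], as the source for the state just after them.
point : ℕ → ℕ → Anchor
point i j = mkA i i j j

_≻_ : Anchor → Anchor → Set
a ≻ b = b ≺ a

-- Chains under construction are stored last anchor first.
lastOf : List Anchor → Anchor
lastOf []      = startAnchor
lastOf (a ∷ _) = a

costOf : List Anchor → ℕ
costOf []      = 0
costOf (a ∷ r) = connect (lastOf r) a + costOf r

costOf-reverse : ∀ b r → costOf (b ∷ r) ≡ connectSum (startAnchor ∷ reverse r ++ [ b ])
costOf-reverse b []      = refl
costOf-reverse b (a ∷ r) = begin
  connect a b + costOf (a ∷ r)                                ≡⟨ cong (connect a b +_) (costOf-reverse a r) ⟩
  connect a b + connectSum (startAnchor ∷ reverse r ++ [ a ]) ≡⟨ +-comm (connect a b) _ ⟩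
  connectSum (startAnchor ∷ reverse r ++ [ a ]) + connect a b ≡⟨ connectSum-snoc startAnchor (reverse r) a b ⟨
  connectSum (startAnchor ∷ (reverse r ++ [ a ]) ++ [ b ])    ≡⟨ cong (λ cs → connectSum (startAnchor ∷ cs ++ [ b ]))
                                                                       (unfold-reverse a r) ⟨
  connectSum (startAnchor ∷ reverse (a ∷ r) ++ [ b ])         ∎
  where
  open ≡-Reasoning
  connectSum-snoc : ∀ s ws a b → connectSum (s ∷ (ws ++ [ a ]) ++ [ b ]) ≡ connectSum (s ∷ ws ++ [ a ]) + connect a b
  connectSum-snoc s []       a b = trans (cong (connect s a +_) (+-identityʳ _)) (cong (_+ connect a b) (sym (+-identityʳ (connect s a))))
  connectSum-snoc s (w ∷ ws) a b = trans (cong (connect s w +_) (connectSum-snoc w ws a b)) (sym (+-assoc (connect s w) _ _))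

connect≤-via-jump : ∀ c x b b′ → jump (qs b) (suc (qe x)) (ts b) (suc (te x)) ≤ c + jump (qs b′) (suc (qe x)) (ts b′) (suc (te x)) →
                    connect x b ≤ c + connect x b′
connect≤-via-jump c x b b′ = subst₂ (λ u v → u ≤ c + v) (sym (connect≡jump x b)) (sym (connect≡jump x b′))

connectSum-from-end : ∀ a ws → connectSum (point (qe a) (te a) ∷ ws) ≡ connectSum (a ∷ ws)
connectSum-from-end a []      = refl
connectSum-from-end a (_ ∷ _) = refl

costOf-mono : ∀ c b b′ r → connect (lastOf r) b ≤ c + connect (lastOf r) b′ → costOf (b ∷ r) ≤ c + costOf (b′ ∷ r)
costOf-mono c b b′ r le = ≤-trans (+-monoˡ-≤ (costOf r) le) (≤-reflexive (+-assoc c _ _))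

Linked-≻⇒reverse-≺ : ∀ {r} → Linked _≻_ r → Linked _≺_ (reverse r)
Linked-≻⇒reverse-≺ {[]}    _ = []
Linked-≻⇒reverse-≺ {a ∷ r} l = subst (Linked _≺_) (sym (unfold-reverse a r)) (snoc a r l)
  where
  snoc-∷ʳ : ∀ ws b a → Linked _≺_ (ws ++ [ b ]) → b ≺ a → Linked _≺_ ((ws ++ [ b ]) ++ [ a ])
  snoc-∷ʳ []           b a _          b≺a = b≺a ∷ [-]
  snoc-∷ʳ (w ∷ [])     b a (r ∷ l)    b≺a = r ∷ snoc-∷ʳ [] b a l b≺a
  snoc-∷ʳ (w ∷ w′ ∷ ws) b a (r ∷ l)   b≺a = r ∷ snoc-∷ʳ (w′ ∷ ws) b a l b≺a
  snoc : ∀ a r → Linked _≻_ (a ∷ r) → Linked _≺_ (reverse r ++ [ a ])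
  snoc a []      _         = [-]
  snoc a (b ∷ r) (a≻b ∷ l) = subst (λ ws → Linked _≺_ (ws ++ [ a ])) (sym (unfold-reverse b r))
                                (snoc-∷ʳ (reverse r) b a (snoc b r l) a≻b)

module FromAlignment {σ} (Q T : List (Fin σ)) (S : List Anchor) (valid : All (IsAnchor Q T) S) where

  open Valid Q T

  RevChain : List Anchor → Set
  RevChain r = All (_∈ S) r × Linked _≻_ r

  cost-del≤ : ∀ r i j → costOf (point (suc i) j ∷ r) ≤ suc (costOf (point i j ∷ r))
  cost-del≤ r i j = costOf-mono 1 (point (suc i) j) (point i j) r
    (connect≤-via-jump 1 x (point (suc i) j) (point i j) (jump-sucA≤ i (suc (qe x)) j (suc (te x))))
    where
    x : Anchor
    x = lastOf r

  cost-ins≤ : ∀ r i j → costOf (point i (suc j) ∷ r) ≤ suc (costOf (point i j ∷ r))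
  cost-ins≤ r i j = costOf-mono 1 (point i (suc j)) (point i j) r
    (connect≤-via-jump 1 x (point i (suc j)) (point i j) (jump-sucB≤ i (suc (qe x)) j (suc (te x))))
    where
    x : Anchor
    x = lastOf r

  cost-diag≤ : ∀ r i j → costOf (point (suc i) (suc j) ∷ r) ≤ suc (costOf (point i j ∷ r))
  cost-diag≤ r i j = costOf-mono 1 (point (suc i) (suc j)) (point i j) r
    (connect≤-via-jump 1 x (point (suc i) (suc j)) (point i j) (jump-sucAB≤ i (suc (qe x)) j (suc (te x))))
    where
    x : Anchor
    x = lastOf r

  cost-diag-inside : ∀ x r i j → i ≤ qe x ⊎ j ≤ te x → costOf (point (suc i) (suc j) ∷ x ∷ r) ≤ costOf (point i j ∷ x ∷ r)
  cost-diag-inside x r i j inside = +-monoˡ-≤ (costOf (x ∷ r))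
    (connect≤-via-jump 0 x (point (suc i) (suc j)) (point i j) (jump-sucAB≤-inside i (suc (qe x)) j (suc (te x)) (s≤s-⊎ inside)))
    where
    s≤s-⊎ : i ≤ qe x ⊎ j ≤ te x → i < suc (qe x) ⊎ j < suc (te x)
    s≤s-⊎ (inj₁ p) = inj₁ (s≤s p)
    s≤s-⊎ (inj₂ p) = inj₂ (s≤s p)

  pop-cost≤ : ∀ a x r → IsAnchor Q T x → qs a < qs x ⊎ ts a < ts x → costOf (a ∷ r) ≤ costOf (a ∷ x ∷ r)
  pop-cost≤ a x r vx before = begin
    connect y a + costOf r                        ≤⟨ +-monoˡ-≤ (costOf r) triangle ⟩
    connect y x + connect x a + costOf r          ≡⟨ xy∙z≈y∙xz (connect y x) (connect x a) (costOf r) ⟩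
    connect x a + (connect y x + costOf r)        ∎
    where
    open ≤-Reasoning
    y : Anchor
    y = lastOf r
    triangle : connect y a ≤ connect y x + connect x a
    triangle = subst₂ _≤_ (sym (connect≡jump y a)) (sym (cong₂ _+_ (connect≡jump y x) (connect≡jump x a)))
      (jump-triangle (qs a) (suc (qe y)) (ts a) (suc (te y)) (qs x) (ts x) (suc (qe x)) (suc (te x)) (on-diagonal vx) before)

  EndsBefore : Anchor → List Anchor → Set
  EndsBefore a []      = ⊤
  EndsBefore a (x ∷ _) = qe x < qe a × te x ≤ te a

  Popped : Anchor → List Anchor → Set
  Popped a r = Σ[ r′ ∈ List Anchor ] RevChain r′ × Linked _≻_ (a ∷ r′) × costOf (a ∷ r′) ≤ costOf (a ∷ r)

  pop : ∀ a r → RevChain r → EndsBefore a r → Popped a r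
  pop a []      _                  _ = [] , ([] , []) , [-] , ≤-refl
  pop a (x ∷ r) (x∈ ∷ r∈ , x≻r) (qe< , te≤) with pop a r (r∈ , Linked.tail x≻r) (ends-before r x≻r)
    where
    ends-before : ∀ r → Linked _≻_ (x ∷ r) → EndsBefore a r
    ends-before []      _                              = tt
    ends-before (y ∷ _) ((_ , qe≤ , _ , te≤′ , _) ∷ _) = ≤-<-trans qe≤ qe< , ≤-trans te≤′ te≤
  ... | r′ , ch , lk , le with qs a <? qs x | ts a <? ts x
  ...   | yes q< | _     = r′ , ch , lk , ≤-trans le (pop-cost≤ a x r (All.lookup valid x∈) (inj₁ q<))
  ...   | no _   | yes t< = r′ , ch , lk , ≤-trans le (pop-cost≤ a x r (All.lookup valid x∈) (inj₂ t<))
  ...   | no q≮  | no t≮  = x ∷ r , (x∈ ∷ r∈ , x≻r) , (x≺a ∷ x≻r) , ≤-refl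
    where
    x≺a : x ≺ a
    x≺a = ≮⇒≥ q≮ , <⇒≤ qe< , ≮⇒≥ t≮ , te≤ , inj₂ (inj₁ qe<)

  enter : ∀ a k r → a ∈ S → k ≤ te a ∸ ts a → RevChain r → EndsBefore a r →
          Σ[ r′ ∈ List Anchor ] RevChain r′ ×
            costOf (point (suc (qs a + k)) (suc (ts a + k)) ∷ r′) ≤ costOf (point (qs a + k) (ts a + k) ∷ r)
  enter a k r a∈ k≤ ch ends with pop a r ch ends
  ... | r′ , (r′∈ , _) , a≻r′ , popped = a ∷ r′ , (a∈ ∷ r′∈ , a≻r′) , (begin
    connect a (point (suc i) (suc j)) + costOf (a ∷ r′)  ≡⟨ cong (_+ costOf (a ∷ r′)) free ⟩
    costOf (a ∷ r′)                                      ≤⟨ popped ⟩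
    costOf (a ∷ r)                                       ≤⟨ costOf-mono 0 a (point i j) r (connect≤-via-jump 0 x a (point i j)
                                                              (jump-mono-AB (qs a) (suc (qe x)) (ts a) (suc (te x)) k)) ⟩
    costOf (point i j ∷ r)                               ∎)
    where
    open ≤-Reasoning
    va : IsAnchor Q T a
    va = All.lookup valid a∈
    i : ℕ
    i = qs a + k
    j : ℕ
    j = ts a + k
    x : Anchor
    x = lastOf r
    shift : ∀ p k t → suc (p + k) + suc t ≡ suc (k + (p + suc t))
    shift = solve-∀
    free : connect a (point (suc i) (suc j)) ≡ 0
    free = trans (connect≡jump a (point (suc i) (suc j)))
      (jump-on-diagonal (suc i) (suc (qe a)) (suc j) (suc (te a)) (s≤s (qs+k≤qe va k≤)) (s≤s (ts+k≤te va k≤))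
        (trans (shift (qs a) k (te a)) (trans (cong (λ z → suc (k + z)) (on-diagonal va)) (sym (shift (ts a) k (qe a))))))

  n : ℕ
  n = length Q
  m : ℕ
  m = length T

  Completion : ℕ → Set
  Completion K = Σ[ r ∈ List Anchor ] RevChain r × costOf (endAnchor n m ∷ r) ≤ K

  paid : ∀ K c → Completion (suc K + c) → Completion (K + suc c)
  paid K c (r , ch , le) = r , ch , ≤-trans le (≤-reflexive (sym (+-suc K c)))

  chain-from-suffix : ∀ {i j} {xs ys : List (Fin σ)} {c} → Alignment S i j xs ys c → length xs + i ≡ suc n → length ys + j ≡ suc m →
                      ∀ r K → RevChain r → costOf (point i j ∷ r) ≤ K → Completion (K + c)
  chain-from-suffix nil refl refl r K ch le = r , ch , ≤-trans le (≤-reflexive (sym (+-identityʳ K)))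
  chain-from-suffix {i} {j} (del {xs = xs} {c = c} al) i≡ j≡ r K ch le =
    paid K c (chain-from-suffix al (trans (+-suc (length xs) i) i≡) j≡ r (suc K) ch (≤-trans (cost-del≤ r i j) (s≤s le)))
  chain-from-suffix {i} {j} (ins {ys = ys} {c = c} al) i≡ j≡ r K ch le =
    paid K c (chain-from-suffix al i≡ (trans (+-suc (length ys) j) j≡) r (suc K) ch (≤-trans (cost-ins≤ r i j) (s≤s le)))
  chain-from-suffix {i} {j} (sub {xs = xs} {ys = ys} {c = c} _ al) i≡ j≡ r K ch le =
    paid K c (chain-from-suffix al (trans (+-suc (length xs) i) i≡) (trans (+-suc (length ys) j) j≡) r (suc K) ch
                                (≤-trans (cost-diag≤ r i j) (s≤s le)))
  chain-from-suffix {i} {j} (unsMatch {xs = xs} {ys = ys} {c = c} _ _ al) i≡ j≡ r K ch le =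
    paid K c (chain-from-suffix al (trans (+-suc (length xs) i) i≡) (trans (+-suc (length ys) j) j≡) r (suc K) ch
                                (≤-trans (cost-diag≤ r i j) (s≤s le)))
  chain-from-suffix {i} {j} (suppMatch {xs = xs} {ys = ys} {c = c} _ supported al) i≡ j≡ r K ch le with find supported
  ... | a , a∈ , k , k≤ , refl , refl = continue r ch le
    where
    va : IsAnchor Q T a
    va = All.lookup valid a∈
    rest : ∀ r K → RevChain r → costOf (point (suc i) (suc j) ∷ r) ≤ K → Completion (K + c)
    rest = chain-from-suffix al (trans (+-suc (length xs) i) i≡) (trans (+-suc (length ys) j) j≡)
    switch : ∀ r → RevChain r → costOf (point i j ∷ r) ≤ K → EndsBefore a r → Completion (K + c)
    switch r ch le ends with enter a k r a∈ k≤ ch ends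
    ... | r′ , ch′ , le′ = rest r′ K ch′ (≤-trans le′ le)
    continue : ∀ r → RevChain r → costOf (point i j ∷ r) ≤ K → Completion (K + c)
    continue []      ch le = switch [] ch le tt
    continue (x ∷ r) ch le with i ≤? qe x | j ≤? te x
    ... | yes i≤ | _      = rest (x ∷ r) K ch (≤-trans (cost-diag-inside x r i j (inj₁ i≤)) le)
    ... | no _   | yes j≤ = rest (x ∷ r) K ch (≤-trans (cost-diag-inside x r i j (inj₂ j≤)) le)
    ... | no i≰  | no j≰  =
      switch (x ∷ r) ch le (<-≤-trans (≰⇒> i≰) (qs+k≤qe va k≤) , <⇒≤ (≤-trans (≰⇒> j≰) (ts+k≤te va k≤)))

  chain-from-alignment : ∀ {c} → Alignment S 1 1 Q T c → Σ[ cs ∈ List Anchor ] IsChain S cs × chainCost Q T cs ≤ c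
  chain-from-alignment al with chain-from-suffix al (+-comm n 1) (+-comm m 1) [] 0 ([] , []) z≤n
  ... | r , (r∈ , r-linked) , le =
    reverse r , (All.tabulate (λ x∈ → All.lookup r∈ (Anyₚ.reverse⁻ x∈)) , Linked-≻⇒reverse-≺ r-linked) ,
    ≤-trans (≤-reflexive (sym (costOf-reverse (endAnchor n m) r))) le

drop-∷ : ∀ {σ} (L : List (Fin σ)) p → p < length L → Σ[ x ∈ Fin σ ] drop p L ≡ x ∷ drop (suc p) L × charAt L (suc p) ≡ just x
drop-∷ (x ∷ L) zero    _       = x , refl , refl
drop-∷ (x ∷ L) (suc p) (s≤s p<) = drop-∷ L p p<

module ToAlignment {σ} (Q T : List (Fin σ)) (S : List Anchor) (valid : All (IsAnchor Q T) S) where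

  open Valid Q T

  n : ℕ
  n = length Q
  m : ℕ
  m = length T

  AlignmentFrom : ℕ → ℕ → ℕ → Set
  AlignmentFrom p q c = Alignment S (suc p) (suc q) (drop p Q) (drop q T) c

  from-heads : ∀ {p q c x y} → drop p Q ≡ x ∷ drop (suc p) Q → drop q T ≡ y ∷ drop (suc q) T →
               Alignment S (suc p) (suc q) (x ∷ drop (suc p) Q) (y ∷ drop (suc q) T) c → AlignmentFrom p q c
  from-heads {p} {q} {c} eq eq′ = subst₂ (λ xs ys → Alignment S (suc p) (suc q) xs ys c) (sym eq) (sym eq′)

  del-step : ∀ {p q c} → p < n → AlignmentFrom (suc p) q c → AlignmentFrom p q (suc c)
  del-step {p} {q} {c} p< al with drop-∷ Q p p<
  ... | _ , eq , _ = subst (λ xs → Alignment S (suc p) (suc q) xs (drop q T) (suc c)) (sym eq) (del al)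

  ins-step : ∀ {p q c} → q < m → AlignmentFrom p (suc q) c → AlignmentFrom p q (suc c)
  ins-step {p} {q} {c} q< al with drop-∷ T q q<
  ... | _ , eq , _ = subst (λ ys → Alignment S (suc p) (suc q) (drop p Q) ys (suc c)) (sym eq) (ins al)

  diag-step : ∀ {p q c} → p < n → q < m → AlignmentFrom (suc p) (suc q) c → Σ[ c′ ∈ ℕ ] c′ ≤ suc c × AlignmentFrom p q c′
  diag-step {p} {q} {c} p< q< al with drop-∷ Q p p< | drop-∷ T q q<
  ... | x , eq , _ | y , eq′ , _ with x ≟ᶠ y | supported? S (suc p) (suc q)
  ...   | yes x≡y | yes s = c     , n≤1+n c , from-heads eq eq′ (suppMatch x≡y s al)
  ...   | yes x≡y | no ¬s = suc c , ≤-refl  , from-heads eq eq′ (unsMatch x≡y ¬s al)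
  ...   | no x≢y  | _     = suc c , ≤-refl  , from-heads eq eq′ (sub x≢y al)

  supported-step : ∀ {p q c} → p < n → q < m → charAt Q (suc p) ≡ charAt T (suc q) → Supported S (suc p) (suc q) →
                   AlignmentFrom (suc p) (suc q) c → AlignmentFrom p q c
  supported-step p< q< same s al with drop-∷ Q _ p< | drop-∷ T _ q<
  ... | x , eq , at-x | y , eq′ , at-y = from-heads eq eq′ (suppMatch (just-injective (trans (sym at-x) (trans same at-y))) s al)

  EntryCost : ℕ → Anchor → Set
  EntryCost K b = ∀ p q → qs b ≤ suc p → qs b + q ≡ ts b + p → p ≤ qe b → q ≤ te b →
                  Σ[ c ∈ ℕ ] AlignmentFrom p q c × c ≤ K

  -- b need not be valid: the end sentinel is handled as the empty anchor mkA (suc n) n (suc m) m.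
  module Approach (b : Anchor) (K : ℕ) (diagonal : qs b + suc (te b) ≡ ts b + suc (qe b)) (qs≤ : qs b ≤ suc (qe b))
                  (qe≤n : qe b ≤ n) (te≤m : te b ≤ m) (entry : EntryCost K b) where

    ts≤ : ts b ≤ suc (te b)
    ts≤ = +-cancelʳ-≤ (suc (qe b)) (ts b) (suc (te b)) (begin
      ts b + suc (qe b)         ≡⟨ diagonal ⟨
      qs b + suc (te b)         ≤⟨ +-monoˡ-≤ (suc (te b)) qs≤ ⟩
      suc (qe b) + suc (te b)   ≡⟨ +-comm (suc (qe b)) (suc (te b)) ⟩
      suc (te b) + suc (qe b)   ∎)
      where open ≤-Reasoning

    -- Where the next cell (suc p , suc q) lies relative to the start and the diagonal of b.
    data Position (p q : ℕ) : Set where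
      before     : suc p < qs b → suc q < ts b → Position p q
      lagsQ      : ts b ≤ suc q → ts b + suc p < qs b + suc q → Position p q
      lagsT      : qs b ≤ suc p → qs b + suc q < ts b + suc p → Position p q
      onDiagonal : qs b ≤ suc p → qs b + q ≡ ts b + p → Position p q

    reached : ∀ p q → qs b ≤ suc p ⊎ ts b ≤ suc q → Position p q
    reached p q r with <-cmp (ts b + suc p) (qs b + suc q)
    ... | tri< lt _ _ = lagsQ (T-reached r) lt
      where
      T-reached : qs b ≤ suc p ⊎ ts b ≤ suc q → ts b ≤ suc q
      T-reached (inj₁ qs≤p) = <⇒≤ (m≤n⇒o+n<m+p⇒o<p qs≤p lt)
      T-reached (inj₂ ts≤q) = ts≤q
    ... | tri> _ _ gt = lagsT (Q-reached r) gt
      where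
      Q-reached : qs b ≤ suc p ⊎ ts b ≤ suc q → qs b ≤ suc p
      Q-reached (inj₁ qs≤p) = qs≤p
      Q-reached (inj₂ ts≤q) = <⇒≤ (m≤n⇒o+n<m+p⇒o<p ts≤q gt)
    ... | tri≈ _ eq _ = onDiagonal (Q-reached r) (suc-injective (trans (sym (+-suc (qs b) q)) (trans (sym eq) (+-suc (ts b) p))))
      where
      Q-reached : qs b ≤ suc p ⊎ ts b ≤ suc q → qs b ≤ suc p
      Q-reached (inj₁ qs≤p) = qs≤p
      Q-reached (inj₂ ts≤q) = m≤n⇒m+o≡p+n⇒p≤o ts≤q eq

    position : ∀ p q → Position p q
    position p q with suc p <? qs b | suc q <? ts b
    ... | yes p< | yes q< = before p< q<
    ... | no p≮  | _      = reached p q (inj₁ (≮⇒≥ p≮))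
    ... | yes _  | no q≮  = reached p q (inj₂ (≮⇒≥ q≮))

    distance : ℕ → ℕ → ℕ
    distance p q = jump (qs b) (suc p) (ts b) (suc q)

    Reach : ℕ → ℕ → Set
    Reach p q = Σ[ c ∈ ℕ ] AlignmentFrom p q c × c ≤ K + distance p q

    pay : ∀ {c d d′} → c ≤ K + d′ → d′ < d → suc c ≤ K + d
    pay {c} {d} {d′} c≤ d′<d = ≤-trans (s≤s c≤) (≤-trans (≤-reflexive (sym (+-suc K d′))) (+-monoʳ-≤ K d′<d))

    -- Each step towards the diagonal costs one and decreases the distance, which serves as fuel.
    approach′ : ∀ f p q → distance p q ≤ f → p ≤ qe b → q ≤ te b → Position p q → Reach p q
    approach′ f p q _ p≤ q≤ (onDiagonal qs≤ diag) with entry p q qs≤ diag p≤ q≤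
    ... | c , al , c≤K = c , al , ≤-trans c≤K (m≤m+n K _)
    approach′ zero p q d≤0 _ _ (before p< q<) = ⊥-elim (n≮0 (≤-trans (jump-sucXY< (qs b) (suc p) (ts b) (suc q) p< q<) d≤0))
    approach′ zero p q d≤0 _ _ (lagsQ ts≤ lag) = ⊥-elim (n≮0 (≤-trans (jump-sucX< (qs b) (suc p) (ts b) (suc q) ts≤ lag) d≤0))
    approach′ zero p q d≤0 _ _ (lagsT qs≤ lag) = ⊥-elim (n≮0 (≤-trans (jump-sucY< (qs b) (suc p) (ts b) (suc q) qs≤ lag) d≤0))
    approach′ (suc f) p q d≤ p≤ q≤ (before p< q<) =
      extend (approach′ f (suc p) (suc q) (≤-pred (≤-trans closer d≤)) p<qe q<te (position (suc p) (suc q)))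
      where
      closer : distance (suc p) (suc q) < distance p q
      closer = jump-sucXY< (qs b) (suc p) (ts b) (suc q) p< q<
      p<qe : suc p ≤ qe b
      p<qe = ≤-pred (≤-trans p< qs≤)
      q<te : suc q ≤ te b
      q<te = ≤-pred (≤-trans q< ts≤)
      extend : Reach (suc p) (suc q) → Reach p q
      extend (c , al , c≤) with diag-step (≤-trans p<qe qe≤n) (≤-trans q<te te≤m) al
      ... | c′ , c′≤ , al′ = c′ , al′ , ≤-trans c′≤ (pay c≤ closer)
    approach′ (suc f) p q d≤ p≤ q≤ (lagsQ ts≤q lag) =
      extend (approach′ f (suc p) q (≤-pred (≤-trans closer d≤)) p<qe q≤ (position (suc p) q))
      where
      closer : distance (suc p) q < distance p q
      closer = jump-sucX< (qs b) (suc p) (ts b) (suc q) ts≤q lag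
      p<qe : p < qe b
      p<qe = ≤-pred (+-cancelˡ-< (ts b) (suc p) (suc (qe b))
                       (<-≤-trans lag (≤-trans (+-monoʳ-≤ (qs b) (s≤s q≤)) (≤-reflexive diagonal))))
      extend : Reach (suc p) q → Reach p q
      extend (c , al , c≤) = suc c , del-step (<-≤-trans p<qe qe≤n) al , pay c≤ closer
    approach′ (suc f) p q d≤ p≤ q≤ (lagsT qs≤p lag) =
      extend (approach′ f p (suc q) (≤-pred (≤-trans closer d≤)) p≤ q<te (position p (suc q)))
      where
      closer : distance p (suc q) < distance p q
      closer = jump-sucY< (qs b) (suc p) (ts b) (suc q) qs≤p lag
      q<te : q < te b
      q<te = ≤-pred (+-cancelˡ-< (qs b) (suc q) (suc (te b))
                       (<-≤-trans lag (≤-trans (+-monoʳ-≤ (ts b) (s≤s p≤)) (≤-reflexive (sym diagonal)))))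
      extend : Reach p (suc q) → Reach p q
      extend (c , al , c≤) = suc c , ins-step (<-≤-trans q<te te≤m) al , pay c≤ closer

    approach : ∀ p q → p ≤ qe b → q ≤ te b → Reach p q
    approach p q p≤ q≤ = approach′ (distance p q) p q ≤-refl p≤ q≤ (position p q)

  follow : ∀ a → a ∈ S → ∀ d p q {c} → p + d ≡ qe a → qs a ≤ suc p → qs a + q ≡ ts a + p →
           AlignmentFrom (qe a) (te a) c → AlignmentFrom p q c
  follow a a∈ zero p q {c} p+0≡ _ diag al = subst₂ (λ u v → AlignmentFrom u v c) (sym p≡) (sym q≡) al
    where
    open ≡-Reasoning
    p≡ : p ≡ qe a
    p≡ = trans (sym (+-identityʳ p)) p+0≡
    q≡ : q ≡ te a
    q≡ = suc-injective (+-cancelˡ-≡ (qs a) _ _ (begin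
      qs a + suc q       ≡⟨ +-suc (qs a) q ⟩
      suc (qs a + q)     ≡⟨ cong suc diag ⟩
      suc (ts a + p)     ≡⟨ cong (λ z → suc (ts a + z)) p≡ ⟩
      suc (ts a + qe a)  ≡⟨ +-suc (ts a) (qe a) ⟨
      ts a + suc (qe a)  ≡⟨ on-diagonal (All.lookup valid a∈) ⟨
      qs a + suc (te a)  ∎))
  follow a a∈ (suc d) p q p+d≡ qs≤ diag al =
    supported-step (<-≤-trans p<qe (qe≤∣Q∣ va)) (<-≤-trans q<te (te≤∣T∣ va)) same (lose a∈ (k , k≤′ , sym i≡ , sym j≡))
      (follow a a∈ d (suc p) (suc q) (trans (sym (+-suc p d)) p+d≡) (m≤n⇒m≤1+n qs≤) diag′ al)
    where
    open ≡-Reasoning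
    va : IsAnchor Q T a
    va = All.lookup valid a∈
    p<qe : p < qe a
    p<qe = subst (p <_) p+d≡ (m<m+n p z<s)
    k : ℕ
    k = suc p ∸ qs a
    k≤ : k ≤ qe a ∸ qs a
    k≤ = ∸-monoˡ-≤ (qs a) p<qe
    k≤′ : k ≤ te a ∸ ts a
    k≤′ = subst (k ≤_) (lengths≡ va) k≤
    diag′ : qs a + suc q ≡ ts a + suc p
    diag′ = trans (+-suc (qs a) q) (trans (cong suc diag) (sym (+-suc (ts a) p)))
    i≡ : qs a + k ≡ suc p
    i≡ = m+[n∸m]≡n qs≤
    j≡ : ts a + k ≡ suc q
    j≡ = +-cancelˡ-≡ (qs a) _ _ (begin
      qs a + (ts a + k)  ≡⟨ x∙yz≈y∙xz (qs a) (ts a) k ⟩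
      ts a + (qs a + k)  ≡⟨ cong (ts a +_) i≡ ⟩
      ts a + suc p       ≡⟨ diag′ ⟨
      qs a + suc q       ∎)
    q<te : q < te a
    q<te = ≤-trans (≤-reflexive (sym j≡)) (ts+k≤te va k≤′)
    same : charAt Q (suc p) ≡ charAt T (suc q)
    same = subst₂ (λ u v → charAt Q u ≡ charAt T v) i≡ j≡ (matches va k k≤)

  NotPast : List Anchor → ℕ → ℕ → Set
  NotPast []      p q = p ≤ n × q ≤ m
  NotPast (a ∷ _) p q = p ≤ qe a × q ≤ te a

  alignment-from-suffix : ∀ cs → All (_∈ S) cs → Linked _≺_ cs → ∀ p q → NotPast cs p q →
                          Σ[ c ∈ ℕ ] AlignmentFrom p q c × c ≤ connectSum (point p q ∷ cs ++ [ endAnchor n m ])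
  alignment-from-suffix [] _ _ p q (p≤ , q≤)
    with Approach.approach end 0 (+-comm (suc n) (suc m)) ≤-refl ≤-refl ≤-refl finish p q p≤ q≤
    where
    end : Anchor
    end = mkA (suc n) n (suc m) m
    finish : EntryCost 0 end
    finish p q n<p+1 diag p≤ _ = 0 , subst₂ (λ u v → AlignmentFrom u v 0) (sym p≡) (sym q≡) empty , z≤n
      where
      p≡ : p ≡ n
      p≡ = ≤-antisym p≤ (≤-pred n<p+1)
      q≡ : q ≡ m
      q≡ = +-cancelˡ-≡ (suc n) _ _ (trans diag (trans (cong (suc m +_) p≡) (cong suc (+-comm m n))))
      empty : AlignmentFrom n m 0
      empty = subst₂ (λ xs ys → Alignment S (suc n) (suc m) xs ys 0) (sym (drop-all n Q ≤-refl)) (sym (drop-all m T ≤-refl)) nil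
  ... | c , al , c≤ = c , al , ≤-trans c≤ (≤-reflexive (trans (sym (connect≡jump (point p q) (endAnchor n m))) (sym (+-identityʳ _))))
  alignment-from-suffix (a ∷ cs) (a∈ ∷ cs∈) a≺cs p q (p≤ , q≤)
    with Approach.approach a K (on-diagonal va) (m≤n⇒m≤1+n (qs≤qe va)) (qe≤∣Q∣ va) (te≤∣T∣ va) entry p q p≤ q≤
    where
    va : IsAnchor Q T a
    va = All.lookup valid a∈
    K : ℕ
    K = connectSum (a ∷ cs ++ [ endAnchor n m ])
    next-not-past : ∀ cs → Linked _≺_ (a ∷ cs) → NotPast cs (qe a) (te a)
    next-not-past []      _                                  = qe≤∣Q∣ va , te≤∣T∣ va
    next-not-past (_ ∷ _) ((_ , qe≤ , _ , te≤ , _) ∷ _) = qe≤ , te≤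
    entry : EntryCost K a
    entry p′ q′ qs≤ diag p′≤ _ with alignment-from-suffix cs cs∈ (Linked.tail a≺cs) (qe a) (te a) (next-not-past cs a≺cs)
    ... | c , al , c≤ = c , follow a a∈ (qe a ∸ p′) p′ q′ (m+[n∸m]≡n p′≤) qs≤ diag al ,
                        ≤-trans c≤ (≤-reflexive (connectSum-from-end a (cs ++ [ endAnchor n m ])))
  ... | c , al , c≤ = c , al , ≤-trans c≤ (≤-reflexive (trans (+-comm K _) (cong (_+ K) (sym (connect≡jump (point p q) a)))))
    where
    K : ℕ
    K = connectSum (a ∷ cs ++ [ endAnchor n m ])

  alignment-from-chain : ∀ {cs} → IsChain S cs → Σ[ c ∈ ℕ ] Alignment S 1 1 Q T c × c ≤ chainCost Q T cs
  alignment-from-chain {[]}    (cs∈ , linked) = alignment-from-suffix [] cs∈ linked 0 0 (z≤n , z≤n)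
  alignment-from-chain {_ ∷ _} (cs∈ , linked) = alignment-from-suffix _ cs∈ linked 0 0 (z≤n , z≤n)

SameSupport : List Anchor → List Anchor → Set
SameSupport A B = ∀ i j → Supported A i j ⇔ Supported B i j

SameSupport-sym : ∀ {A B} → SameSupport A B → SameSupport B A
SameSupport-sym A≈B i j = ⇔.sym (A≈B i j)

SameSupport-trans : ∀ {A B C} → SameSupport A B → SameSupport B C → SameSupport A C
SameSupport-trans A≈B B≈C i j = ⇔.trans (A≈B i j) (B≈C i j)

Alignment-resp-support : ∀ {σ A B i j} {xs ys : List (Fin σ)} {c} → SameSupport A B → Alignment A i j xs ys c → Alignment B i j xs ys c
Alignment-resp-support A≈B nil                                = nil
Alignment-resp-support {i = i} {j} A≈B (suppMatch eq s al)   = suppMatch eq (Equivalence.to (A≈B i j) s) (Alignment-resp-support A≈B al)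
Alignment-resp-support {i = i} {j} A≈B (unsMatch eq ¬s al)   =
  unsMatch eq (λ s → ¬s (Equivalence.from (A≈B i j) s)) (Alignment-resp-support A≈B al)
Alignment-resp-support A≈B (sub neq al)                       = sub neq (Alignment-resp-support A≈B al)
Alignment-resp-support A≈B (del al)                           = del (Alignment-resp-support A≈B al)
Alignment-resp-support A≈B (ins al)                           = ins (Alignment-resp-support A≈B al)

AnchoredED-resp-support : ∀ {σ} (Q T : List (Fin σ)) {A B} → SameSupport A B → ∀ d → AnchoredED Q T A d ⇔ AnchoredED Q T B d
AnchoredED-resp-support Q T A≈B d = mk⇔ (transfer A≈B) (transfer (SameSupport-sym A≈B))
  where
  transfer : ∀ {A B} → SameSupport A B → AnchoredED Q T A d → AnchoredED Q T B d
  transfer A≈B (al , least) = Alignment-resp-support A≈B al , λ c al′ → least c (Alignment-resp-support (SameSupport-sym A≈B) al′)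

Diagonal-cong : ∀ {s s′ t t′ L L′ i j} → s ≡ s′ → t ≡ t′ → L ≡ L′ → Diagonal s t L i j ⇔ Diagonal s′ t′ L′ i j
Diagonal-cong refl refl refl = ⇔.refl

Diagonal-∪ : ∀ s t L d L′ {i j} → d ≤ suc L → L ≤ d + L′ →
             Diagonal s t (d + L′) i j ⇔ (Diagonal s t L i j ⊎ Diagonal (s + d) (t + d) L′ i j)
Diagonal-∪ s t L d L′ d≤ L≤ = mk⇔ to from
  where
  to : ∀ {i j} → Diagonal s t (d + L′) i j → Diagonal s t L i j ⊎ Diagonal (s + d) (t + d) L′ i j
  to (k , k≤ , refl , refl) with k ≤? L
  ... | yes k≤L = inj₁ (k , k≤L , refl , refl)
  ... | no  k≰L = inj₂ (k ∸ d , ≤-trans (∸-monoˡ-≤ d k≤) (≤-reflexive (m+n∸m≡n d L′)) , shift s , shift t)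
    where
    shift : ∀ s → s + k ≡ s + d + (k ∸ d)
    shift s = sym (trans (+-assoc s d (k ∸ d)) (cong (s +_) (m+[n∸m]≡n (≤-trans d≤ (≰⇒> k≰L)))))
  from : ∀ {i j} → Diagonal s t L i j ⊎ Diagonal (s + d) (t + d) L′ i j → Diagonal s t (d + L′) i j
  from (inj₁ (k , k≤ , i≡ , j≡)) = k , ≤-trans k≤ L≤ , i≡ , j≡
  from (inj₂ (k , k≤ , i≡ , j≡)) = d + k , +-monoʳ-≤ d k≤ , trans i≡ (+-assoc s d k) , trans j≡ (+-assoc t d k)

↭⇒SameSupport : ∀ {A B} → A ↭ B → SameSupport A B
↭⇒SameSupport A↭B i j = mk⇔ (Any-resp-↭ A↭B) (Any-resp-↭ (↭-sym A↭B))

∷-SameSupport : ∀ {a b c B} → (∀ i j → Covers a i j ⇔ (Covers b i j ⊎ Covers c i j)) → SameSupport (a ∷ B) (b ∷ c ∷ B)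
∷-SameSupport {a} {b} {c} {B} covers i j = mk⇔ to from
  where
  to : Supported (a ∷ B) i j → Supported (b ∷ c ∷ B) i j
  to (here cov) with Equivalence.to (covers i j) cov
  ... | inj₁ cov-b = here cov-b
  ... | inj₂ cov-c = there (here cov-c)
  to (there s) = there (there s)
  from : Supported (b ∷ c ∷ B) i j → Supported (a ∷ B) i j
  from (here cov)         = here (Equivalence.from (covers i j) (inj₁ cov))
  from (there (here cov)) = here (Equivalence.from (covers i j) (inj₂ cov))
  from (there (there s))  = there s

Any-map-All : ∀ {X : Set} {V P R : X → Set} {xs} → (∀ {x} → V x → P x → R x) → All V xs → Any P xs → Any R xs
Any-map-All f (v ∷ _)  (here p)  = here (f v p)
Any-map-All f (_ ∷ vs) (there p) = there (Any-map-All f vs p)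

module Rearrangement {σ} (Q T : List (Fin σ)) where

  open Valid Q T

  matches-on : ∀ {a i j} → IsAnchor Q T a → Covers a i j → charAt Q i ≡ charAt T j
  matches-on va (k , k≤ , refl , refl) = matches va k (subst (k ≤_) (sym (lengths≡ va)) k≤)

  IsAnchor-by-cover : ∀ {b} → 1 ≤ qs b → qs b ≤ qe b → qe b ≤ length Q → 1 ≤ ts b → ts b ≤ te b → te b ≤ length T →
                      qe b ∸ qs b ≡ te b ∸ ts b → (∀ {i j} → Covers b i j → charAt Q i ≡ charAt T j) → IsAnchor Q T b
  IsAnchor-by-cover 1≤ qs≤ qe≤ 1≤′ ts≤ te≤ len chars =
    1≤ , qs≤ , qe≤ , 1≤′ , ts≤ , te≤ , len , λ k k≤ → chars (k , subst (k ≤_) len k≤ , refl , refl)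

  normal-form : ∀ {s e t f} → IsAnchor Q T (mkA s e t f) → Σ[ L ∈ ℕ ] e ≡ s + L × f ≡ t + L
  normal-form {s} {e} {t} {f} va =
    e ∸ s , sym (m+[n∸m]≡n (qs≤qe va)) , trans (sym (m+[n∸m]≡n (ts≤te va))) (cong (t +_) (sym (lengths≡ va)))

  piece : Anchor → ℕ → Anchor
  piece a k = mkA (qs a + k) (qs a + k) (ts a + k) (ts a + k)

  piece-cell : ∀ {a k i j} → Covers (piece a k) i j → i ≡ qs a + k × j ≡ ts a + k
  piece-cell {a} {k} (k′ , k′≤ , i≡ , j≡) = trans i≡ (at-start (qs a + k)) , trans j≡ (at-start (ts a + k))
    where
    k′≡0 : k′ ≡ 0
    k′≡0 = n≤0⇒n≡0 (≤-trans k′≤ (≤-reflexive (n∸n≡0 (ts a + k))))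
    at-start : ∀ x → x + k′ ≡ x
    at-start x = trans (cong (x +_) k′≡0) (+-identityʳ x)

  break-covers : ∀ {a} → IsAnchor Q T a → ∀ i j → Supported (breakAnchor a) i j ⇔ Covers a i j
  break-covers {a} va i j = mk⇔ to from
    where
    to : Supported (breakAnchor a) i j → Covers a i j
    to s with find (Anyₚ.map⁻ s)
    ... | k , k∈ , cov with piece-cell {a} {k} cov
    ...   | i≡ , j≡ = k , subst (k ≤_) (lengths≡ va) (≤-pred (∈-upTo⁻ k∈)) , i≡ , j≡
    from : Covers a i j → Supported (breakAnchor a) i j
    from (k , k≤ , refl , refl) = Anyₚ.map⁺ (lose (∈-upTo⁺ (s≤s (subst (k ≤_) (sym (lengths≡ va)) k≤)))
                                                  (0 , z≤n , sym (+-identityʳ _) , sym (+-identityʳ _)))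

  piece-valid : ∀ {a k} → IsAnchor Q T a → k ≤ qe a ∸ qs a → IsAnchor Q T (piece a k)
  piece-valid {a} {k} va k≤ = IsAnchor-by-cover
    (≤-trans (1≤qs va) (m≤m+n _ k)) ≤-refl (≤-trans (qs+k≤qe va k≤′) (qe≤∣Q∣ va))
    (≤-trans (1≤ts va) (m≤m+n _ k)) ≤-refl (≤-trans (ts+k≤te va k≤′) (te≤∣T∣ va))
    (trans (n∸n≡0 (qs a + k)) (sym (n∸n≡0 (ts a + k))))
    (λ cov → let i≡ , j≡ = piece-cell {a} {k} cov in matches-on va (k , k≤′ , i≡ , j≡))
    where
    k≤′ : k ≤ te a ∸ ts a
    k≤′ = subst (k ≤_) (lengths≡ va) k≤

  breakAll-support : ∀ {A} → All (IsAnchor Q T) A → SameSupport A (breakAll A)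
  breakAll-support valid i j = mk⇔
    (λ s → Anyₚ.concatMap⁺ breakAnchor (Any-map-All (λ va → Equivalence.from (break-covers va i j)) valid s))
    (λ s → Any-map-All (λ va → Equivalence.to (break-covers va i j)) valid (Anyₚ.concatMap⁻ breakAnchor s))

  breakAll-valid : ∀ {A} → All (IsAnchor Q T) A → All (IsAnchor Q T) (breakAll A)
  breakAll-valid valid = Allₚ.concat⁺ (Allₚ.map⁺ (All.map break-valid valid))
    where
    break-valid : ∀ {a} → IsAnchor Q T a → All (IsAnchor Q T) (breakAnchor a)
    break-valid va = Allₚ.map⁺ (All.tabulate (λ k∈ → piece-valid va (≤-pred (∈-upTo⁻ k∈))))

  split-anchor : ∀ a x → IsAnchor Q T a → x < qe a ∸ qs a →
                 let p₁ = mkA (qs a) (qs a + x) (ts a) (ts a + x)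
                     p₂ = mkA (suc (qs a + x)) (qe a) (suc (ts a + x)) (te a)
                 in IsAnchor Q T p₁ × IsAnchor Q T p₂ × (∀ i j → Covers a i j ⇔ (Covers p₁ i j ⊎ Covers p₂ i j))
  split-anchor (mkA s _ t _) x va x< with normal-form va
  ... | L , refl , refl = valid₁ , valid₂ , covers
    where
    x<L : x < L
    x<L = ≤-trans x< (≤-reflexive (m+n∸m≡n s L))
    rest : ∀ s → (s + L) ∸ suc (s + x) ≡ L ∸ suc x
    rest s = trans (cong ((s + L) ∸_) (sym (+-suc s x))) ([m+n]∸[m+o]≡n∸o s L (suc x))
    covers : ∀ i j → Covers (mkA s (s + L) t (t + L)) i j ⇔
                     (Covers (mkA s (s + x) t (t + x)) i j ⊎ Covers (mkA (suc (s + x)) (s + L) (suc (t + x)) (t + L)) i j)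
    covers i j = ⇔.trans (Diagonal-cong refl refl (trans (m+n∸m≡n t L) (sym (m+[n∸m]≡n x<L))))
                 (⇔.trans (Diagonal-∪ s t x (suc x) (L ∸ suc x) ≤-refl (≤-trans (n≤1+n x) (m≤m+n _ _)))
                          (Diagonal-cong refl refl (sym (m+n∸m≡n t x))
                            ⊎-⇔ Diagonal-cong (+-suc s x) (+-suc t x) (sym (rest t))))
    valid₁ : IsAnchor Q T (mkA s (s + x) t (t + x))
    valid₁ = IsAnchor-by-cover (1≤qs va) (m≤m+n s x) (≤-trans (+-monoʳ-≤ s (<⇒≤ x<L)) (qe≤∣Q∣ va))
                               (1≤ts va) (m≤m+n t x) (≤-trans (+-monoʳ-≤ t (<⇒≤ x<L)) (te≤∣T∣ va))
                               (trans (m+n∸m≡n s x) (sym (m+n∸m≡n t x)))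
                               (λ cov → matches-on va (Equivalence.from (covers _ _) (inj₁ cov)))
    valid₂ : IsAnchor Q T (mkA (suc (s + x)) (s + L) (suc (t + x)) (t + L))
    valid₂ = IsAnchor-by-cover (s≤s z≤n) (≤-trans (≤-reflexive (sym (+-suc s x))) (+-monoʳ-≤ s x<L)) (qe≤∣Q∣ va)
                               (s≤s z≤n) (≤-trans (≤-reflexive (sym (+-suc t x))) (+-monoʳ-≤ t x<L)) (te≤∣T∣ va)
                               (trans (rest s) (sym (rest t)))
                               (λ cov → matches-on va (Equivalence.from (covers _ _) (inj₂ cov)))

  merge-anchor : ∀ a a′ → IsAnchor Q T a → IsAnchor Q T a′ → a ≺ a′ → connect a a′ ≡ 0 →
                 IsAnchor Q T (merge a a′) × (∀ i j → Covers (merge a a′) i j ⇔ (Covers a i j ⊎ Covers a′ i j))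
  merge-anchor (mkA s _ t _) (mkA s′ _ t′ _) va va′ a≺a′ perfect with normal-form va | normal-form va′
  ... | L , refl , refl | L′ , refl , refl with m≤n⇒∃[o]m+o≡n (proj₁ a≺a′)
  ... | d , refl with jump≡0⇒on-diagonal (s + d) (suc (s + L)) t′ (suc (t + L))
                        (trans (sym (connect≡jump (mkA s (s + L) t (t + L)) (mkA (s + d) (s + d + L′) t′ (t′ + L′)))) perfect)
  ... | d-bound , _ , diagonal with +-cancelʳ-≡ (suc (s + L)) t′ (t + d) (trans (sym diagonal) (swap s d t L))
    where
    swap : ∀ s d t L → s + d + suc (t + L) ≡ t + d + suc (s + L)
    swap = solve-∀
  ... | refl = valid , covers
    where
    d≤ : d ≤ suc L
    d≤ = +-cancelˡ-≤ s d (suc L) (≤-trans d-bound (≤-reflexive (sym (+-suc s L))))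
    L≤ : L ≤ d + L′
    L≤ = +-cancelˡ-≤ s L (d + L′) (≤-trans (proj₁ (proj₂ a≺a′)) (≤-reflexive (+-assoc s d L′)))
    span : ∀ s → (s + d + L′) ∸ s ≡ d + L′
    span s = trans (cong (_∸ s) (+-assoc s d L′)) (m+n∸m≡n s (d + L′))
    covers : ∀ i j → Covers (mkA s (s + d + L′) t (t + d + L′)) i j ⇔
                     (Covers (mkA s (s + L) t (t + L)) i j ⊎ Covers (mkA (s + d) (s + d + L′) (t + d) (t + d + L′)) i j)
    covers i j = ⇔.trans (Diagonal-cong refl refl (span t))
                 (⇔.trans (Diagonal-∪ s t L d L′ d≤ L≤)
                          (Diagonal-cong refl refl (sym (m+n∸m≡n t L)) ⊎-⇔ Diagonal-cong refl refl (sym (m+n∸m≡n (t + d) L′))))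
    valid : IsAnchor Q T (mkA s (s + d + L′) t (t + d + L′))
    valid = IsAnchor-by-cover (1≤qs va) (≤-trans (m≤m+n s d) (m≤m+n _ L′)) (qe≤∣Q∣ va′)
                              (1≤ts va) (≤-trans (m≤m+n t d) (m≤m+n _ L′)) (te≤∣T∣ va′)
                              (trans (span s) (sym (span t)))
                              (λ cov → [_,_] (matches-on va) (matches-on va′) (Equivalence.to (covers _ _) cov))

  derivable-support : ∀ {A B} → Derivable A B → All (IsAnchor Q T) A → SameSupport A B × All (IsAnchor Q T) B
  derivable-support done valid = (λ i j → ⇔.refl) , valid
  derivable-support (split a x A↭ x< der) valid with All-resp-↭ A↭ valid
  ... | va ∷ vB with split-anchor a x va x<
  ...   | v₁ , v₂ , covers with derivable-support der (v₁ ∷ v₂ ∷ vB)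
  ...     | same , valid′ = SameSupport-trans (↭⇒SameSupport A↭) (SameSupport-trans (∷-SameSupport covers) same) , valid′
  derivable-support (merg a a′ A↭ a≺a′ perfect der) valid with All-resp-↭ A↭ valid
  ... | va ∷ va′ ∷ vB with merge-anchor a a′ va va′ a≺a′ perfect
  ...   | vm , covers with derivable-support der (vm ∷ vB)
  ...     | same , valid′ =
    SameSupport-trans (↭⇒SameSupport A↭) (SameSupport-trans (SameSupport-sym (∷-SameSupport covers)) same) , valid′

Least : (ℕ → Set) → ℕ → Set
Least P d = P d × (∀ c → P c → d ≤ c)

Simulates : (ℕ → Set) → (ℕ → Set) → Set
Simulates R P = ∀ {c} → P c → Σ[ c′ ∈ ℕ ] c′ ≤ c × R c′

Least-⇔ : ∀ {P R : ℕ → Set} → Simulates R P → Simulates P R → ∀ d → Least P d ⇔ Least R d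
Least-⇔ P⇒R R⇒P d = mk⇔ (transfer P⇒R R⇒P) (transfer R⇒P P⇒R)
  where
  transfer : ∀ {P R : ℕ → Set} → Simulates R P → Simulates P R → Least P d → Least R d
  transfer {P} {R} P⇒R R⇒P (Pd , least) with P⇒R Pd
  ... | c , c≤d , Rc = subst R (≤-antisym c≤d (lower Rc)) Rc , λ c′ → lower
    where
    lower : ∀ {c} → R c → d ≤ c
    lower Rc with R⇒P Rc
    ... | c′ , c′≤c , Pc′ = ≤-trans (least c′ Pc′) c′≤c

ChainCost : ∀ {σ} → List (Fin σ) → List (Fin σ) → List Anchor → ℕ → Set
ChainCost Q T A c = Σ[ cs ∈ List Anchor ] IsChain A cs × chainCost Q T cs ≡ c

OptChainCost⇔Least : ∀ {σ} (Q T : List (Fin σ)) A d → OptChainCost Q T A d ⇔ Least (ChainCost Q T A) d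
OptChainCost⇔Least Q T A d = mk⇔ (λ (ch , least) → ch , λ { _ (cs , isChain , refl) → least cs isChain })
                                  (λ (ch , least) → ch , λ cs isChain → least _ (cs , isChain , refl))

OptChainCost⇔AnchoredED : ∀ {σ} (Q T : List (Fin σ)) A → All (IsAnchor Q T) A → ∀ d → OptChainCost Q T A d ⇔ AnchoredED Q T A d
OptChainCost⇔AnchoredED Q T A valid d = ⇔.trans (OptChainCost⇔Least Q T A d) (Least-⇔ chain⇒alignment alignment⇒chain d)
  where
  chain⇒alignment : Simulates (λ c → Alignment A 1 1 Q T c) (ChainCost Q T A)
  chain⇒alignment (_ , isChain , refl) with ToAlignment.alignment-from-chain Q T A valid isChain
  ... | c′ , al , c′≤ = c′ , c′≤ , al
  alignment⇒chain : Simulates (ChainCost Q T A) (λ c → Alignment A 1 1 Q T c)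
  alignment⇒chain al with FromAlignment.chain-from-alignment Q T A valid al
  ... | cs , isChain , cost≤ = chainCost Q T cs , cost≤ , cs , isChain , refl

OptChainCost-resp-support : ∀ {σ} (Q T : List (Fin σ)) {A B} → All (IsAnchor Q T) A → All (IsAnchor Q T) B →
                            SameSupport A B → ∀ d → OptChainCost Q T A d ⇔ OptChainCost Q T B d
OptChainCost-resp-support Q T {A} {B} validA validB A≈B d =
  ⇔.trans (OptChainCost⇔AnchoredED Q T A validA d)
    (⇔.trans (AnchoredED-resp-support Q T A≈B d) (⇔.sym (OptChainCost⇔AnchoredED Q T B validB d)))

corollary1 : ∀ {σ : ℕ} (Q T : List (Fin σ)) → 0 < length Q → 0 < length T →
    (A : List Anchor) → All (IsAnchor Q T) A →
    (A'' : List Anchor) → Derivable A A'' →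
    ∀ (d : ℕ) →
      (AnchoredED Q T A d ⇔ AnchoredED Q T (breakAll A) d) ×
      (AnchoredED Q T A d ⇔ AnchoredED Q T A'' d) ×
      (OptChainCost Q T A d ⇔ OptChainCost Q T (breakAll A) d) ×
      (OptChainCost Q T A d ⇔ OptChainCost Q T A'' d)
corollary1 Q T _ _ A valid A'' derivation d =
  AnchoredED-resp-support Q T broken d ,
  AnchoredED-resp-support Q T rearranged d ,
  OptChainCost-resp-support Q T valid (breakAll-valid valid) broken d ,
  OptChainCost-resp-support Q T valid (proj₂ (derivable-support derivation valid)) rearranged d
  where
  open Rearrangement Q T
  broken : SameSupport A (breakAll A)
  broken = breakAll-support valid
  rearranged : SameSupport A A''
  rearranged = proj₁ (derivable-support derivation valid)
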